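{- Let $r$ be a positive integer and $j,n$ non-negative integers. Then the number of partitions of $n$ with exactly $j$ parts divisible by $r$ (counted with multiplicity) equals the number of partitions of $n$ in which the largest $r$-repeating part is $j$.
   Context: A partition of $n$ is a non-increasing sequence of positive integers summing to $n$. For a positive integer $r$, an $r$-repeating part of a partition is an integer occurring at least $r$ times in it; the largest $r$-repeating part is the largest such integer, taken to be $0$ if no integer occurs at least $r$ times. -}

module Defs where

open import Data.Nat using (ℕ; zero; suc; _≤_; _≥_; _<_; _⊔_; _≤?_)
open import Data.Nat.Divisibility using (_∣_; _∣?_)
open import Data.Nat.Properties using (_≟_)
open import Data.List using (List; []; _∷_; filter; length; foldr)
open import Data.Nat.ListAction using (sum)
open import Data.List.Relation.Unary.All using (All)
open import Data.List.Relation.Unary.Linked using (Linked)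
open import Data.Product using (_×_)
open import Relation.Binary.PropositionalEquality using (_≡_)

IsPartition : ℕ → List ℕ → Set
IsPartition n p = Linked _≥_ p × All (λ x → 1 ≤ x) p × sum p ≡ n

multiplicity : ℕ → List ℕ → ℕ
multiplicity x p = length (filter (_≟ x) p)

partsDivisibleBy : ℕ → List ℕ → ℕ
partsDivisibleBy r p = length (filter (r ∣?_) p)

largestRepeatingPart : ℕ → List ℕ → ℕ
largestRepeatingPart r p = foldr _⊔_ 0 (filter (λ x → r ≤? multiplicity x p) p)

{-# OPTIONS --safe #-}
-- Every partition
-- splits uniquely as β ∪ r·α, where β has no part divisible by r and r·α multiplies the parts of α
-- by r; its number of parts divisible by r is then the number of parts of α. It also splits uniquely
-- as ρ ∪ ν^r, where every multiplicity of ρ is below r and ν^r multiplies the multiplicities of ν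
-- by r; its largest r-repeating part is then the largest part of ν. Conjugation exchanges "j parts"
-- with "largest part j", and Glaisher's bijection (split β by multiplicities, recurse on the
-- quotient and scale its parts back up) matches partitions without parts divisible by r with
-- partitions without r-repeating parts. Both preserve size, so β ∪ r·α ↦ glaisher β ∪ (conjugate α)^r
-- is a bijection turning the first statistic into the second.
module Submission where

open import Data.Bool using (true; false)
open import Data.List using (List; []; _∷_; _++_; _∷ʳ_; map; filter; foldr; length; replicate)
open import Data.List.Properties
  using (filter-++; filter-all; filter-none; filter-accept; filter-reject; foldr-++; map-++; map-∘; length-++; length-replicate)
open import Data.List.Relation.Unary.All as All using (All; []; _∷_)
open import Data.List.Relation.Unary.All.Properties using (++⁺; replicate⁺; all-filter; filter⁺; map⁺)
open import Data.List.Relation.Unary.Linked as Linked using (Linked; []; [-]; _∷_)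
open import Data.List.Relation.Unary.Linked.Properties using (Linked⇒All)
open import Data.Nat
open import Data.Nat.Divisibility using (_∣_; _∣?_; divides; n∣m*n; ∣⇒≤; 1∣_; n∣m⇒m%n≡0)
open import Data.Nat.DivMod
open import Data.Nat.ListAction using (sum)
open import Data.Nat.ListAction.Properties using (sum-++)
open import Data.Nat.Properties
open import Algebra.Properties.CommutativeSemigroup +-commutativeSemigroup using (interchange; x∙yz≈y∙xz)
open import Data.Nat.Solver using (module +-*-Solver)
open import Data.Product using (_×_; _,_; proj₁; proj₂; Σ; map₁; map₂; swap)
open import Function using (_∘_; flip)
open import Function.Bundles using (_↔_; mk↔ₛ′)
open import Relation.Binary.Definitions using (tri<; tri≈; tri>)
open import Relation.Binary.PropositionalEquality
open import Relation.Nullary using (¬_; yes; no; does; ¬?; contradiction)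
open import Relation.Unary using (Decidable)
open import Defs

open +-*-Solver using (solve; _:+_; _:*_; _:=_; con)

Run : Set
Run = ℕ × ℕ

AllParts : (ℕ → Set) → List Run → Set
AllParts P = All (P ∘ proj₁)

AllMults : (ℕ → Set) → List Run → Set
AllMults P = All (P ∘ proj₂)

-- A run (v , c) stands for c copies of the part v; runs are listed by strictly decreasing part.
data Canonical : List Run → Set where
  [] : Canonical []
  cons : ∀ {v c R} → 1 ≤ v → 1 ≤ c → AllParts (_< v) R → Canonical R → Canonical ((v , c) ∷ R)

weight : List Run → ℕ
weight [] = 0
weight ((v , c) ∷ R) = c * v + weight R

size : List Run → ℕ
size = sum ∘ map proj₂

largest : List Run → ℕ
largest [] = 0
largest ((v , _) ∷ _) = v

IsRunPartition : ℕ → List Run → Set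
IsRunPartition n R = Canonical R × weight R ≡ n

allParts-weaken : ∀ {u v R} → u ≤ v → AllParts (_< u) R → AllParts (_< v) R
allParts-weaken u≤v = All.map (λ p → <-≤-trans p u≤v)

weight≤0⇒[] : ∀ {R} → Canonical R → weight R ≤ 0 → R ≡ []
weight≤0⇒[] [] _ = refl
weight≤0⇒[] (cons 1≤v 1≤c _ _) le = contradiction (≤-trans (*-mono-≤ 1≤c 1≤v) (≤-trans (m≤m+n _ _) le)) λ ()

allParts-≤largest : ∀ {R} → Canonical R → AllParts (_≤ largest R) R
allParts-≤largest [] = []
allParts-≤largest (cons _ _ below _) = ≤-refl ∷ All.map <⇒≤ below

largest<head : ∀ {v c R} → Canonical ((v , c) ∷ R) → largest R < v
largest<head (cons 1≤v _ [] _) = 1≤v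
largest<head (cons _ _ (u<v ∷ _) _) = u<v

-- merge-∷ x R S = merge (x ∷ R) S, split off so that both recursions are structural.
merge : List Run → List Run → List Run
merge-∷ : Run → List Run → List Run → List Run

merge [] S = S
merge (x ∷ R) S = merge-∷ x R S

merge-∷ x R [] = x ∷ R
merge-∷ x R (y ∷ S) with <-cmp (proj₁ x) (proj₁ y)
... | tri< _ _ _ = y ∷ merge-∷ x R S
... | tri≈ _ _ _ = (proj₁ x , proj₂ x + proj₂ y) ∷ merge R S
... | tri> _ _ _ = x ∷ merge R (y ∷ S)

merge-[]ʳ : ∀ R → merge R [] ≡ R
merge-[]ʳ [] = refl
merge-[]ʳ (_ ∷ _) = refl

merge-headˡ : ∀ {v c} R S → AllParts (_< v) S → merge ((v , c) ∷ R) S ≡ (v , c) ∷ merge R S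
merge-headˡ R [] [] = cong (_ ∷_) (sym (merge-[]ʳ R))
merge-headˡ {v} R ((u , d) ∷ S) (u<v ∷ _) with <-cmp v u
... | tri< v<u _ _ = contradiction u<v (<-asym v<u)
... | tri≈ _ v≡u _ = contradiction u<v (<-irrefl (sym v≡u))
... | tri> _ _ _ = refl

merge-headʳ : ∀ {u d} R S → AllParts (_< u) R → merge R ((u , d) ∷ S) ≡ (u , d) ∷ merge R S
merge-headʳ [] S [] = refl
merge-headʳ {u} ((v , c) ∷ R) S (v<u ∷ _) with <-cmp v u
... | tri< _ _ _ = refl
... | tri≈ _ v≡u _ = contradiction v<u (<-irrefl v≡u)
... | tri> _ _ u<v = contradiction v<u (<-asym u<v)

merge-≡ : ∀ v c d R S → merge ((v , c) ∷ R) ((v , d) ∷ S) ≡ (v , c + d) ∷ merge R S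
merge-≡ v c d R S with <-cmp v v
... | tri< v<v _ _ = contradiction v<v (<-irrefl refl)
... | tri≈ _ _ _ = refl
... | tri> _ _ v<v = contradiction v<v (<-irrefl refl)

module _ (P : List Run → List Run → List Run → Set)
  (case-[]ˡ : ∀ S → P [] S S)
  (case-[]ʳ : ∀ x R → P (x ∷ R) [] (x ∷ R))
  (case-< : ∀ v c R u d S → v < u → P ((v , c) ∷ R) S (merge ((v , c) ∷ R) S) →
    P ((v , c) ∷ R) ((u , d) ∷ S) ((u , d) ∷ merge ((v , c) ∷ R) S))
  (case-≡ : ∀ v c R u d S → v ≡ u → P R S (merge R S) →
    P ((v , c) ∷ R) ((u , d) ∷ S) ((v , c + d) ∷ merge R S))
  (case-> : ∀ v c R u d S → u < v → P R ((u , d) ∷ S) (merge R ((u , d) ∷ S)) →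
    P ((v , c) ∷ R) ((u , d) ∷ S) ((v , c) ∷ merge R ((u , d) ∷ S)))
  where

  merge-elim : ∀ R S → P R S (merge R S)
  merge-∷-elim : ∀ x R S → P (x ∷ R) S (merge-∷ x R S)

  merge-elim [] S = case-[]ˡ S
  merge-elim (x ∷ R) S = merge-∷-elim x R S

  merge-∷-elim x R [] = case-[]ʳ x R
  merge-∷-elim x R (y ∷ S) with <-cmp (proj₁ x) (proj₁ y)
  ... | tri< x<y _ _ = case-< _ _ R _ _ S x<y (merge-∷-elim x R S)
  ... | tri≈ _ x≡y _ = case-≡ _ _ R _ _ S x≡y (merge-elim R S)
  ... | tri> _ _ y<x = case-> _ _ R _ _ S y<x (merge-elim R (y ∷ S))

allParts-merge : ∀ {P} R S → AllParts P R → AllParts P S → AllParts P (merge R S)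
allParts-merge {P} = merge-elim (λ R S M → AllParts P R → AllParts P S → AllParts P M)
  (λ _ _ pS → pS)
  (λ _ _ pR _ → pR)
  (λ { _ _ _ _ _ _ _ ih pR (pu ∷ pS) → pu ∷ ih pR pS })
  (λ { _ _ _ _ _ _ _ ih (pv ∷ pR) (_ ∷ pS) → pv ∷ ih pR pS })
  (λ { _ _ _ _ _ _ _ ih (pv ∷ pR) pS → pv ∷ ih pR pS })

canonical-merge : ∀ R S → Canonical R → Canonical S → Canonical (merge R S)
canonical-merge = merge-elim (λ R S M → Canonical R → Canonical S → Canonical M)
  (λ _ _ cS → cS)
  (λ _ _ cR _ → cR)
  (λ { v c R u d S v<u ih cR@(cons _ _ bR _) (cons 1≤u 1≤d bS cS) →
         cons 1≤u 1≤d (allParts-merge _ S (v<u ∷ allParts-weaken (<⇒≤ v<u) bR) bS) (ih cR cS) })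
  (λ { v c R _ d S refl ih (cons 1≤v 1≤c bR cR) (cons _ _ bS cS) →
         cons 1≤v (≤-trans 1≤c (m≤m+n c d)) (allParts-merge R S bR bS) (ih cR cS) })
  (λ { v c R u d S u<v ih (cons 1≤v 1≤c bR cR) cS@(cons _ _ bS _) →
         cons 1≤v 1≤c (allParts-merge R _ bR (u<v ∷ allParts-weaken (<⇒≤ u<v) bS)) (ih cR cS) })

weight-merge : ∀ R S → weight (merge R S) ≡ weight R + weight S
weight-merge = merge-elim (λ R S M → weight M ≡ weight R + weight S)
  (λ _ → refl)
  (λ _ R → sym (+-identityʳ _))
  (λ v c R u d S _ ih → begin
    d * u + weight (merge ((v , c) ∷ R) S) ≡⟨ cong (d * u +_) ih ⟩
    d * u + (c * v + weight R + weight S)  ≡⟨ x∙yz≈y∙xz (d * u) (c * v + weight R) (weight S) ⟩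
    c * v + weight R + (d * u + weight S)  ∎)
  (λ { v c R _ d S refl ih → begin
    (c + d) * v + weight (merge R S)           ≡⟨ cong₂ _+_ (*-distribʳ-+ v c d) ih ⟩
    (c * v + d * v) + (weight R + weight S)    ≡⟨ interchange (c * v) (d * v) (weight R) (weight S) ⟩
    c * v + weight R + (d * v + weight S)      ∎ })
  (λ v c R u d S _ ih → trans (cong (c * v +_) ih) (sym (+-assoc (c * v) (weight R) _)))
  where open ≡-Reasoning

allMults-merge : ∀ {P Q} R S → AllMults P R → AllMults P S → AllParts (¬_ ∘ Q) R → AllParts Q S → AllMults P (merge R S)
allMults-merge {P} {Q} = merge-elim (λ R S M → AllMults P R → AllMults P S → AllParts (¬_ ∘ Q) R → AllParts Q S → AllMults P M)
  (λ _ _ pS _ _ → pS)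
  (λ _ _ pR _ _ _ → pR)
  (λ { _ _ _ _ _ _ _ ih pR (pd ∷ pS) ¬qR (_ ∷ qS) → pd ∷ ih pR pS ¬qR qS })
  (λ { _ _ _ _ _ _ refl _ _ _ (¬qv ∷ _) (qv ∷ _) → contradiction qv ¬qv })
  (λ { _ _ _ _ _ _ _ ih (pc ∷ pR) pS (_ ∷ ¬qR) qS → pc ∷ ih pR pS ¬qR qS })

canonical-filter : ∀ {Q : Run → Set} (Q? : Decidable Q) {R} → Canonical R → Canonical (filter Q? R)
canonical-filter Q? [] = []
canonical-filter Q? {x ∷ _} (cons 1≤v 1≤c bR cR) with Q? x
... | yes _ = cons 1≤v 1≤c (filter⁺ Q? bR) (canonical-filter Q? cR)
... | no _ = canonical-filter Q? cR

filterParts : ∀ {P : ℕ → Set} → Decidable P → List Run → List Run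
filterParts P? = filter (P? ∘ proj₁)

module _ {P : ℕ → Set} (P? : Decidable P) where

  filterParts-merge-∁ : ∀ R S → AllParts (¬_ ∘ P) R → AllParts P S → filterParts (¬? ∘ P?) (merge R S) ≡ R
  filterParts-merge-∁ = merge-elim (λ R S M → AllParts (¬_ ∘ P) R → AllParts P S → filterParts (¬? ∘ P?) M ≡ R)
    (λ _ _ pS → filter-none ((¬? ∘ P?) ∘ proj₁) (All.map (λ p ¬p → ¬p p) pS))
    (λ _ _ ¬pR _ → filter-all ((¬? ∘ P?) ∘ proj₁) ¬pR)
    (λ { _ _ _ u d _ _ ih ¬pR (pu ∷ pS) → trans (filter-reject ((¬? ∘ P?) ∘ proj₁) {u , d} (λ ¬pu → ¬pu pu)) (ih ¬pR pS) })
    (λ { _ _ _ _ _ _ refl _ (¬pv ∷ _) (pv ∷ _) → contradiction pv ¬pv })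
    (λ { v c _ _ _ _ _ ih (¬pv ∷ ¬pR) pS → trans (filter-accept ((¬? ∘ P?) ∘ proj₁) {v , c} ¬pv) (cong ((v , c) ∷_) (ih ¬pR pS)) })

  filterParts-merge : ∀ R S → AllParts (¬_ ∘ P) R → AllParts P S → filterParts P? (merge R S) ≡ S
  filterParts-merge = merge-elim (λ R S M → AllParts (¬_ ∘ P) R → AllParts P S → filterParts P? M ≡ S)
    (λ _ _ pS → filter-all (P? ∘ proj₁) pS)
    (λ _ _ ¬pR _ → filter-none (P? ∘ proj₁) ¬pR)
    (λ { _ _ _ u d _ _ ih ¬pR (pu ∷ pS) → trans (filter-accept (P? ∘ proj₁) {u , d} pu) (cong ((u , d) ∷_) (ih ¬pR pS)) })
    (λ { _ _ _ _ _ _ refl _ (¬pv ∷ _) (pv ∷ _) → contradiction pv ¬pv })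
    (λ { v c _ _ _ _ _ ih (¬pv ∷ ¬pR) pS → trans (filter-reject (P? ∘ proj₁) {v , c} ¬pv) (ih ¬pR pS) })

  merge-filterParts-∁ : ∀ {R} → Canonical R → merge (filterParts (¬? ∘ P?) R) (filterParts P? R) ≡ R
  merge-filterParts-∁ [] = refl
  merge-filterParts-∁ {(v , c) ∷ R} (cons _ _ bR cR) with P? v
  ... | yes _ = trans (merge-headʳ _ _ (filter⁺ _ bR)) (cong ((v , c) ∷_) (merge-filterParts-∁ cR))
  ... | no _ = trans (merge-headˡ _ _ (filter⁺ _ bR)) (cong ((v , c) ∷_) (merge-filterParts-∁ cR))

expand : List Run → List ℕ
expand [] = []
expand ((v , c) ∷ R) = replicate c v ++ expand R

consPart : ℕ → List Run → List Run
consPart x [] = (x , 1) ∷ []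
consPart x ((v , c) ∷ R) with x ≟ v
... | yes _ = (v , suc c) ∷ R
... | no _ = (x , 1) ∷ (v , c) ∷ R

group : List ℕ → List Run
group = foldr consPart []

expand-consPart : ∀ x R → expand (consPart x R) ≡ x ∷ expand R
expand-consPart x [] = refl
expand-consPart x ((v , c) ∷ R) with x ≟ v
... | yes refl = refl
... | no _ = refl

expand-group : ∀ p → expand (group p) ≡ p
expand-group [] = refl
expand-group (x ∷ p) = trans (expand-consPart x (group p)) (cong (x ∷_) (expand-group p))

consPart-replicate : ∀ c {v R} → AllParts (_< v) R → foldr consPart R (replicate (suc c) v) ≡ (v , suc c) ∷ R
consPart-replicate zero {R = []} [] = refl
consPart-replicate zero {v} {(u , _) ∷ _} (u<v ∷ _) with v ≟ u
... | yes refl = contradiction u<v (<-irrefl refl)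
... | no _ = refl
consPart-replicate (suc c) {v} bR rewrite consPart-replicate c bR with v ≟ v
... | yes _ = refl
... | no v≢v = contradiction refl v≢v

group-expand : ∀ {R} → Canonical R → group (expand R) ≡ R
group-expand [] = refl
group-expand {(v , suc c) ∷ R} (cons _ _ bR cR) = begin
  foldr consPart [] (replicate (suc c) v ++ expand R) ≡⟨ foldr-++ consPart [] (replicate (suc c) v) (expand R) ⟩
  foldr consPart (group (expand R)) (replicate (suc c) v) ≡⟨ cong (λ S → foldr consPart S (replicate (suc c) v)) (group-expand cR) ⟩
  foldr consPart R (replicate (suc c) v) ≡⟨ consPart-replicate c bR ⟩
  (v , suc c) ∷ R ∎
  where open ≡-Reasoning

allParts-consPart : ∀ {P x R} → P x → AllParts P R → AllParts P (consPart x R)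
allParts-consPart px [] = px ∷ []
allParts-consPart {x = x} {(v , c) ∷ R} px (pv ∷ pR) with x ≟ v
... | yes _ = pv ∷ pR
... | no _ = px ∷ pv ∷ pR

allParts-group : ∀ {P p} → All P p → AllParts P (group p)
allParts-group [] = []
allParts-group (px ∷ ps) = allParts-consPart px (allParts-group ps)

canonical-consPart : ∀ {x R} → 1 ≤ x → AllParts (_≤ x) R → Canonical R → Canonical (consPart x R)
canonical-consPart 1≤x [] [] = cons 1≤x ≤-refl [] []
canonical-consPart {x} {(v , c) ∷ R} 1≤x (v≤x ∷ _) cR@(cons 1≤v _ bR cR′) with x ≟ v
... | yes _ = cons 1≤v (s≤s z≤n) bR cR′
... | no x≢v = cons 1≤x (s≤s z≤n) (v<x ∷ allParts-weaken (<⇒≤ v<x) bR) cR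
  where v<x = ≤∧≢⇒< v≤x (x≢v ∘ sym)

canonical-group : ∀ {n p} → IsPartition n p → Canonical (group p)
canonical-group {p = []} _ = []
canonical-group {p = x ∷ p} (sorted , 1≤x ∷ pos , refl) =
  canonical-consPart 1≤x (allParts-group (All.tail (Linked⇒All {R = _≥_} (flip ≤-trans) ≤-refl sorted)))
    (canonical-group (Linked.tail sorted , pos , refl))

linked-replicate-++ : ∀ c {v xs} → All (_≤ v) xs → Linked _≥_ xs → Linked _≥_ (replicate c v ++ xs)
linked-replicate-++ zero _ sorted = sorted
linked-replicate-++ (suc zero) [] _ = [-]
linked-replicate-++ (suc zero) (x≤v ∷ _) sorted = x≤v ∷ sorted
linked-replicate-++ (suc (suc c)) bound sorted = ≤-refl ∷ linked-replicate-++ (suc c) bound sorted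

allParts-expand : ∀ {P R} → AllParts P R → All P (expand R)
allParts-expand [] = []
allParts-expand {R = (_ , c) ∷ _} (pv ∷ pR) = ++⁺ (replicate⁺ c pv) (allParts-expand pR)

linked-expand : ∀ {R} → Canonical R → Linked _≥_ (expand R)
linked-expand [] = []
linked-expand {(_ , c) ∷ _} (cons _ _ bR cR) = linked-replicate-++ c (allParts-expand (All.map <⇒≤ bR)) (linked-expand cR)

sum-replicate : ∀ c v → sum (replicate c v) ≡ c * v
sum-replicate zero v = refl
sum-replicate (suc c) v = cong (v +_) (sum-replicate c v)

sum-expand : ∀ R → sum (expand R) ≡ weight R
sum-expand [] = refl
sum-expand ((v , c) ∷ R) = trans (sum-++ (replicate c v) (expand R)) (cong₂ _+_ (sum-replicate c v) (sum-expand R))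

parts-positive : ∀ {R} → Canonical R → AllParts (1 ≤_) R
parts-positive [] = []
parts-positive (cons 1≤v _ _ cR) = 1≤v ∷ parts-positive cR

isPartition-expand : ∀ {R} → Canonical R → IsPartition (weight R) (expand R)
isPartition-expand {R} cR = linked-expand cR , allParts-expand (parts-positive cR) , sum-expand R

weight-group : ∀ {n p} → IsPartition n p → weight (group p) ≡ n
weight-group {p = p} (_ , _ , sum≡n) = trans (sym (sum-expand (group p))) (trans (cong sum (expand-group p)) sum≡n)

filter-expand : ∀ {P : ℕ → Set} (P? : Decidable P) R → filter P? (expand R) ≡ expand (filterParts P? R)
filter-expand P? [] = refl
filter-expand P? ((v , c) ∷ R) with P? v
... | yes pv = begin
  filter P? (replicate c v ++ expand R)           ≡⟨ filter-++ P? (replicate c v) (expand R) ⟩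
  filter P? (replicate c v) ++ filter P? (expand R) ≡⟨ cong₂ _++_ (filter-all P? (replicate⁺ c pv)) (filter-expand P? R) ⟩
  replicate c v ++ expand (filterParts P? R)      ∎
  where open ≡-Reasoning
... | no ¬pv = begin
  filter P? (replicate c v ++ expand R)           ≡⟨ filter-++ P? (replicate c v) (expand R) ⟩
  filter P? (replicate c v) ++ filter P? (expand R) ≡⟨ cong₂ _++_ (filter-none P? (replicate⁺ c ¬pv)) (filter-expand P? R) ⟩
  expand (filterParts P? R)                        ∎
  where open ≡-Reasoning

length-expand : ∀ R → length (expand R) ≡ size R
length-expand [] = refl
length-expand ((v , c) ∷ R) = trans (length-++ (replicate c v)) (cong₂ _+_ (length-replicate c) (length-expand R))

length-filter-expand : ∀ {P : ℕ → Set} (P? : Decidable P) R → length (filter P? (expand R)) ≡ size (filterParts P? R)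
length-filter-expand P? R = trans (cong length (filter-expand P? R)) (length-expand (filterParts P? R))

partsDivisibleBy-expand : ∀ r R → partsDivisibleBy r (expand R) ≡ size (filterParts (r ∣?_) R)
partsDivisibleBy-expand r = length-filter-expand (r ∣?_)

multiplicities-expand : ∀ {R} → Canonical R → All (λ x → multiplicity (proj₁ x) (expand R) ≡ proj₂ x) R
multiplicities-expand {R} cR = All.map (trans (length-filter-expand (_≟ _) R)) (sizes cR)
  where
  sizes : ∀ {R} → Canonical R → All (λ x → size (filterParts (_≟ proj₁ x) R) ≡ proj₂ x) R
  sizes [] = []
  sizes {(v , c) ∷ R} (cons _ _ bR cR) = head ∷ All.zipWith tail (bR , sizes cR)
    where
    head : size (filterParts (_≟ v) ((v , c) ∷ R)) ≡ c
    head rewrite filter-accept ((_≟ v) ∘ proj₁) {(v , c)} {R} refl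
               | filter-none ((_≟ v) ∘ proj₁) (All.map (λ u<v → <⇒≢ u<v) bR) = +-identityʳ c
    tail : ∀ {x} → proj₁ x < v × size (filterParts (_≟ proj₁ x) R) ≡ proj₂ x →
           size (filterParts (_≟ proj₁ x) ((v , c) ∷ R)) ≡ proj₂ x
    tail {x} (u<v , eq) rewrite filter-reject ((_≟ proj₁ x) ∘ proj₁) {(v , c)} {R} (<⇒≢ u<v ∘ sym) = eq

foldr-⊔-replicate : ∀ c {v b} → b ≤ v → foldr _⊔_ b (replicate (suc c) v) ≡ v
foldr-⊔-replicate zero b≤v = m≥n⇒m⊔n≡m b≤v
foldr-⊔-replicate (suc c) {v} b≤v = trans (cong (v ⊔_) (foldr-⊔-replicate c b≤v)) (⊔-idem v)

foldr-⊔-expand : ∀ {R} → Canonical R → foldr _⊔_ 0 (expand R) ≡ largest R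
foldr-⊔-expand [] = refl
foldr-⊔-expand {(v , suc c) ∷ R} cR@(cons _ _ _ cR′) = begin
  foldr _⊔_ 0 (replicate (suc c) v ++ expand R)             ≡⟨ foldr-++ _⊔_ 0 (replicate (suc c) v) (expand R) ⟩
  foldr _⊔_ (foldr _⊔_ 0 (expand R)) (replicate (suc c) v) ≡⟨ cong (λ b → foldr _⊔_ b (replicate (suc c) v)) (foldr-⊔-expand cR′) ⟩
  foldr _⊔_ (largest R) (replicate (suc c) v)              ≡⟨ foldr-⊔-replicate c (<⇒≤ (largest<head cR)) ⟩
  v                                                        ∎
  where open ≡-Reasoning

filter-cong : ∀ {A : Set} {P Q : A → Set} (P? : Decidable P) (Q? : Decidable Q) {xs} →
  All (λ x → does (P? x) ≡ does (Q? x)) xs → filter P? xs ≡ filter Q? xs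
filter-cong P? Q? [] = refl
filter-cong P? Q? {x ∷ _} (eq ∷ eqs) with does (P? x) | does (Q? x) | filter-cong P? Q? eqs
... | false | false | ih = ih
... | true  | true  | ih = cong (x ∷_) ih

largestRepeatingPart-expand : ∀ r {R} → Canonical R →
  largestRepeatingPart r (expand R) ≡ largest (filter ((r ≤?_) ∘ proj₂) R)
largestRepeatingPart-expand r {R} cR = begin
  foldr _⊔_ 0 (filter repeating? (expand R))              ≡⟨ cong (foldr _⊔_ 0) (filter-expand repeating? R) ⟩
  foldr _⊔_ 0 (expand (filterParts repeating? R))         ≡⟨ cong (foldr _⊔_ 0 ∘ expand) (filter-cong _ _ (All.map (cong (does ∘ (r ≤?_))) (multiplicities-expand cR))) ⟩
  foldr _⊔_ 0 (expand (filter ((r ≤?_) ∘ proj₂) R))       ≡⟨ foldr-⊔-expand (canonical-filter _ cR) ⟩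
  largest (filter ((r ≤?_) ∘ proj₂) R)                    ∎
  where
  open ≡-Reasoning
  repeating? = λ x → r ≤? multiplicity x (expand R)

isPartition-irrelevant : ∀ {n p} (x y : IsPartition n p) → x ≡ y
isPartition-irrelevant (s₁ , p₁ , e₁) (s₂ , p₂ , e₂) =
  cong₂ _,_ (Linked.irrelevant ≤-irrelevant s₁ s₂) (cong₂ _,_ (All.irrelevant ≤-irrelevant p₁ p₂) (≡-irrelevant e₁ e₂))

module _ {n : ℕ} (s t : List ℕ → ℕ) (F G : List Run → List Run)
  (F-closed : ∀ {R} → IsRunPartition n R → IsRunPartition n (F R))
  (G-closed : ∀ {S} → IsRunPartition n S → IsRunPartition n (G S))
  (G-F : ∀ {R} → IsRunPartition n R → G (F R) ≡ R)
  (F-G : ∀ {S} → IsRunPartition n S → F (G S) ≡ S)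
  (t-F : ∀ {R} → IsRunPartition n R → t (expand (F R)) ≡ s (expand R))
  where

  private
    group-closed : ∀ {p} → IsPartition n p → IsRunPartition n (group p)
    group-closed ip = canonical-group ip , weight-group ip

    expand-closed : ∀ {R} → IsRunPartition n R → IsPartition n (expand R)
    expand-closed {R} (cR , refl) = isPartition-expand cR

    ≡-onParts : ∀ {u : List ℕ → ℕ} {j p q} {x : IsPartition n p × u p ≡ j} {y : IsPartition n q × u q ≡ j} →
      p ≡ q → _≡_ {A = Σ (List ℕ) (λ p → IsPartition n p × u p ≡ j)} (p , x) (q , y)
    ≡-onParts {x = ip , e} {iq , e′} refl = cong₂ (λ a b → (_ , a , b)) (isPartition-irrelevant ip iq) (≡-irrelevant e e′)

  partitions-↔ : ∀ j → Σ (List ℕ) (λ p → IsPartition n p × s p ≡ j) ↔ Σ (List ℕ) (λ p → IsPartition n p × t p ≡ j)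
  partitions-↔ j = mk↔ₛ′ to from to-from from-to
    where
    to : Σ (List ℕ) (λ p → IsPartition n p × s p ≡ j) → Σ (List ℕ) (λ p → IsPartition n p × t p ≡ j)
    to (p , ip , sp≡j) = expand (F (group p)) , expand-closed (F-closed gp) ,
      trans (t-F gp) (trans (cong s (expand-group p)) sp≡j)
      where gp = group-closed ip

    from : Σ (List ℕ) (λ p → IsPartition n p × t p ≡ j) → Σ (List ℕ) (λ p → IsPartition n p × s p ≡ j)
    from (p , ip , tp≡j) = expand (G (group p)) , expand-closed (G-closed gp) ,
      trans (sym (t-F (G-closed gp))) (trans (cong (t ∘ expand) (F-G gp)) (trans (cong t (expand-group p)) tp≡j))
      where gp = group-closed ip

    to-from : ∀ y → to (from y) ≡ y
    to-from (p , ip , _) = ≡-onParts (begin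
      expand (F (group (expand (G (group p))))) ≡⟨ cong (expand ∘ F) (group-expand (proj₁ (G-closed gp))) ⟩
      expand (F (G (group p)))                  ≡⟨ cong expand (F-G gp) ⟩
      expand (group p)                          ≡⟨ expand-group p ⟩
      p                                         ∎)
      where
      open ≡-Reasoning
      gp = group-closed ip

    from-to : ∀ x → from (to x) ≡ x
    from-to (p , ip , _) = ≡-onParts (begin
      expand (G (group (expand (F (group p))))) ≡⟨ cong (expand ∘ G) (group-expand (proj₁ (F-closed gp))) ⟩
      expand (G (F (group p)))                  ≡⟨ cong expand (G-F gp) ⟩
      expand (group p)                          ≡⟨ expand-group p ⟩
      p                                         ∎)
      where
      open ≡-Reasoning
      gp = group-closed ip

-- Conjugation

-- toGaps R lists, for every run (v , c) of R, the pair (v − v′ , c) where v′ is the next smaller part;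
-- conjugation reads the Young diagram by columns, which swaps the pairs and reverses their order.
toGaps : List Run → List Run
toGaps [] = []
toGaps ((v , c) ∷ R) = (v ∸ largest R , c) ∷ toGaps R

fromGaps : List Run → List Run
fromGaps [] = []
fromGaps ((d , c) ∷ D) = (d + largest (fromGaps D) , c) ∷ fromGaps D

transpose : List Run → List Run
transpose [] = []
transpose (x ∷ D) = transpose D ∷ʳ swap x

conjugate : List Run → List Run
conjugate = fromGaps ∘ transpose ∘ toGaps

AllPositive : List Run → Set
AllPositive = All (λ x → 1 ≤ proj₁ x × 1 ≤ proj₂ x)

fromGaps-toGaps : ∀ {R} → Canonical R → fromGaps (toGaps R) ≡ R
fromGaps-toGaps [] = refl
fromGaps-toGaps {(v , c) ∷ R} cR@(cons _ _ _ cR′) rewrite fromGaps-toGaps cR′ =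
  cong (λ u → (u , c) ∷ R) (m∸n+n≡m (<⇒≤ (largest<head cR)))

toGaps-fromGaps : ∀ D → toGaps (fromGaps D) ≡ D
toGaps-fromGaps [] = refl
toGaps-fromGaps ((d , c) ∷ D) = cong₂ (λ e → (e , c) ∷_) (m+n∸n≡m d (largest (fromGaps D))) (toGaps-fromGaps D)

positive-toGaps : ∀ {R} → Canonical R → AllPositive (toGaps R)
positive-toGaps [] = []
positive-toGaps cR@(cons _ 1≤c _ cR′) = (m<n⇒0<n∸m (largest<head cR) , 1≤c) ∷ positive-toGaps cR′

canonical-fromGaps : ∀ {D} → AllPositive D → Canonical (fromGaps D)
canonical-fromGaps [] = []
canonical-fromGaps {(d , _) ∷ _} ((1≤d , 1≤c) ∷ pD) =
  cons (≤-trans 1≤d (m≤m+n d _)) 1≤c (All.map (λ u≤L → +-mono-≤ 1≤d u≤L) (allParts-≤largest cD)) cD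
  where cD = canonical-fromGaps pD

transpose-∷ʳ : ∀ D x → transpose (D ∷ʳ x) ≡ swap x ∷ transpose D
transpose-∷ʳ [] x = refl
transpose-∷ʳ (y ∷ D) x = cong (_∷ʳ swap y) (transpose-∷ʳ D x)

transpose-involutive : ∀ D → transpose (transpose D) ≡ D
transpose-involutive [] = refl
transpose-involutive (x ∷ D) = trans (transpose-∷ʳ (transpose D) (swap x)) (cong (x ∷_) (transpose-involutive D))

positive-transpose : ∀ {D} → AllPositive D → AllPositive (transpose D)
positive-transpose [] = []
positive-transpose ((1≤d , 1≤c) ∷ pD) = ++⁺ (positive-transpose pD) ((1≤c , 1≤d) ∷ [])

largest-fromGaps : ∀ D → largest (fromGaps D) ≡ sum (map proj₁ D)
largest-fromGaps [] = refl
largest-fromGaps ((d , c) ∷ D) = cong (d +_) (largest-fromGaps D)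

size-∷ʳ : ∀ D x → size (D ∷ʳ x) ≡ size D + proj₂ x
size-∷ʳ D x = trans (cong sum (map-++ proj₂ D (x ∷ []))) (trans (sum-++ (map proj₂ D) _) (cong (size D +_) (+-identityʳ _)))

size-transpose : ∀ D → size (transpose D) ≡ sum (map proj₁ D)
size-transpose [] = refl
size-transpose ((d , c) ∷ D) = trans (size-∷ʳ (transpose D) (c , d)) (trans (cong (_+ d) (size-transpose D)) (+-comm _ d))

-- Appending a gap d of multiplicity c adds d to each of the size D old parts and c new parts d.
weight-fromGaps-∷ʳ : ∀ D d c → weight (fromGaps (D ∷ʳ (d , c))) ≡ weight (fromGaps D) + d * (size D + c)
weight-fromGaps-∷ʳ [] d c = solve 2 (λ d c → c :* (d :+ con 0) :+ con 0 := con 0 :+ d :* (con 0 :+ c)) refl d c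
weight-fromGaps-∷ʳ ((d′ , c′) ∷ D) d c
  rewrite largest-fromGaps (D ∷ʳ (d , c)) | map-++ proj₁ D ((d , c) ∷ []) | sum-++ (map proj₁ D) (d ∷ [])
        | sym (largest-fromGaps D) | weight-fromGaps-∷ʳ D d c =
  solve 7 (λ c′ d′ L d W s c → c′ :* (d′ :+ (L :+ (d :+ con 0))) :+ (W :+ d :* (s :+ c))
                             := (c′ :* (d′ :+ L) :+ W) :+ d :* ((c′ :+ s) :+ c))
    refl c′ d′ (largest (fromGaps D)) d (weight (fromGaps D)) (size D) c

weight-fromGaps-transpose : ∀ D → weight (fromGaps (transpose D)) ≡ weight (fromGaps D)
weight-fromGaps-transpose [] = refl
weight-fromGaps-transpose ((d , c) ∷ D)
  rewrite weight-fromGaps-∷ʳ (transpose D) c d | weight-fromGaps-transpose D | size-transpose D | sym (largest-fromGaps D) =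
  trans (+-comm (weight (fromGaps D)) _) (cong (λ s → c * s + weight (fromGaps D)) (+-comm _ d))

canonical-conjugate : ∀ {R} → Canonical R → Canonical (conjugate R)
canonical-conjugate cR = canonical-fromGaps (positive-transpose (positive-toGaps cR))

conjugate-involutive : ∀ {R} → Canonical R → conjugate (conjugate R) ≡ R
conjugate-involutive {R} cR = begin
  fromGaps (transpose (toGaps (fromGaps (transpose (toGaps R))))) ≡⟨ cong (fromGaps ∘ transpose) (toGaps-fromGaps (transpose (toGaps R))) ⟩
  fromGaps (transpose (transpose (toGaps R)))                     ≡⟨ cong fromGaps (transpose-involutive (toGaps R)) ⟩
  fromGaps (toGaps R)                                             ≡⟨ fromGaps-toGaps cR ⟩
  R                                                               ∎
  where open ≡-Reasoning

weight-conjugate : ∀ {R} → Canonical R → weight (conjugate R) ≡ weight R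
weight-conjugate {R} cR = trans (weight-fromGaps-transpose (toGaps R)) (cong weight (fromGaps-toGaps cR))

largest-conjugate : ∀ R → largest (conjugate R) ≡ size R
largest-conjugate R = begin
  largest (fromGaps (transpose (toGaps R)))     ≡⟨ largest-fromGaps (transpose (toGaps R)) ⟩
  sum (map proj₁ (transpose (toGaps R)))        ≡⟨ size-transpose (transpose (toGaps R)) ⟨
  size (transpose (transpose (toGaps R)))       ≡⟨ cong size (transpose-involutive (toGaps R)) ⟩
  size (toGaps R)                               ≡⟨ size-toGaps R ⟩
  size R                                        ∎
  where
  open ≡-Reasoning
  size-toGaps : ∀ R → size (toGaps R) ≡ size R
  size-toGaps [] = refl
  size-toGaps ((_ , c) ∷ R) = cong (c +_) (size-toGaps R)


-- Splitting by divisibility of parts and of multiplicities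

consRun : Run → List Run → List Run
consRun (v , zero) R = R
consRun (v , suc c) R = (v , suc c) ∷ R

allParts-consRun : ∀ {P v} c {R} → P v → AllParts P R → AllParts P (consRun (v , c) R)
allParts-consRun zero _ pR = pR
allParts-consRun (suc c) pv pR = pv ∷ pR

allMults-consRun : ∀ {P} v {c R} → P c → AllMults P R → AllMults P (consRun (v , c) R)
allMults-consRun v {zero} _ pR = pR
allMults-consRun v {suc c} pc pR = pc ∷ pR

canonical-consRun : ∀ {v} c {R} → 1 ≤ v → AllParts (_< v) R → Canonical R → Canonical (consRun (v , c) R)
canonical-consRun zero _ _ cR = cR
canonical-consRun (suc c) 1≤v bR cR = cons 1≤v (s≤s z≤n) bR cR

consRun-suc : ∀ {v c R} → 1 ≤ c → consRun (v , c) R ≡ (v , c) ∷ R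
consRun-suc {c = suc c} _ = refl

-- Used with b the weight of the recursive argument of the Glaisher maps: for r = 1 their domains
-- contain the empty partition only, otherwise the weight at least halves.
fuel-descent : ∀ r .{{_ : NonZero r}} {a b f} → (r ≡ 1 → b ≡ 0) → a + r * b ≤ suc f → b ≤ f
fuel-descent _ {b = zero} _ _ = z≤n
fuel-descent 1 {b = suc _} r≡1⇒b≡0 _ = contradiction (r≡1⇒b≡0 refl) λ ()
fuel-descent (suc (suc k)) {a} {suc b} {f} _ le = ≤-pred (begin
  suc (suc b)                   ≤⟨ s≤s (m≤n+m (suc b) b) ⟩
  suc b + suc b                 ≤⟨ +-monoʳ-≤ (suc b) (m≤m+n (suc b) (k * suc b)) ⟩
  suc (suc k) * suc b           ≤⟨ m≤n+m _ a ⟩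
  a + suc (suc k) * suc b       ≤⟨ le ⟩
  suc f                         ∎)
  where open ≤-Reasoning

module _ (r : ℕ) .{{_ : NonZero r}} where

  NoDivisiblePart : List Run → Set
  NoDivisiblePart R = Canonical R × AllParts (¬_ ∘ (r ∣_)) R

  NoRepeatingPart : List Run → Set
  NoRepeatingPart R = Canonical R × AllMults (_< r) R

  scaleParts : List Run → List Run
  scaleParts = map (map₁ (_* r))

  unscaleParts : List Run → List Run
  unscaleParts = map (map₁ (_/ r))

  undivided : List Run → List Run
  undivided = filterParts (¬? ∘ (r ∣?_))

  divided : List Run → List Run
  divided = unscaleParts ∘ filterParts (r ∣?_)

  joinParts : List Run → List Run → List Run
  joinParts β α = merge β (scaleParts α)

  canonical-scaleParts : ∀ {α} → Canonical α → Canonical (scaleParts α)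
  canonical-scaleParts [] = []
  canonical-scaleParts {(v , _) ∷ _} (cons 1≤v 1≤c bα cα) =
    cons (≤-trans 1≤v (m≤m*n v r)) 1≤c (map⁺ (All.map (*-monoˡ-< r) bα)) (canonical-scaleParts cα)

  canonical-unscaleParts : ∀ {R} → Canonical R → AllParts (r ∣_) R → Canonical (unscaleParts R)
  canonical-unscaleParts [] [] = []
  canonical-unscaleParts (cons 1≤v 1≤c bR cR) (r∣v ∷ r∣R) =
    cons (m≥n⇒m/n>0 (∣⇒≤ {{>-nonZero 1≤v}} r∣v)) 1≤c (map⁺ (All.zipWith (λ (u<v , r∣u) → /-mono-< r∣u r∣v u<v) (bR , r∣R)))
      (canonical-unscaleParts cR r∣R)
    where
    /-mono-< : ∀ {u v} → r ∣ u → r ∣ v → u < v → u / r < v / r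
    /-mono-< (divides a refl) (divides b refl) u<v =
      subst₂ _<_ (sym (m*n/n≡m a r)) (sym (m*n/n≡m b r)) (*-cancelʳ-< r a b u<v)

  unscaleParts-scaleParts : ∀ α → unscaleParts (scaleParts α) ≡ α
  unscaleParts-scaleParts [] = refl
  unscaleParts-scaleParts ((v , c) ∷ α) = cong₂ (λ u → (u , c) ∷_) (m*n/n≡m v r) (unscaleParts-scaleParts α)

  scaleParts-unscaleParts : ∀ {R} → AllParts (r ∣_) R → scaleParts (unscaleParts R) ≡ R
  scaleParts-unscaleParts [] = refl
  scaleParts-unscaleParts {(v , c) ∷ _} (r∣v ∷ r∣R) = cong₂ (λ u → (u , c) ∷_) (m/n*n≡m r∣v) (scaleParts-unscaleParts r∣R)

  weight-scaleParts : ∀ α → weight (scaleParts α) ≡ r * weight α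
  weight-scaleParts [] = sym (*-zeroʳ r)
  weight-scaleParts ((v , c) ∷ α) = begin
    c * (v * r) + weight (scaleParts α) ≡⟨ cong₂ _+_ (sym (*-assoc c v r)) (weight-scaleParts α) ⟩
    c * v * r + r * weight α             ≡⟨ cong (_+ r * weight α) (*-comm (c * v) r) ⟩
    r * (c * v) + r * weight α           ≡⟨ *-distribˡ-+ r (c * v) (weight α) ⟨
    r * (c * v + weight α)               ∎
    where open ≡-Reasoning

  noDivisiblePart-undivided : ∀ {R} → Canonical R → NoDivisiblePart (undivided R)
  noDivisiblePart-undivided {R} cR = canonical-filter _ cR , all-filter _ R

  canonical-divided : ∀ {R} → Canonical R → Canonical (divided R)
  canonical-divided {R} cR = canonical-unscaleParts (canonical-filter _ cR) (all-filter _ R)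

  canonical-joinParts : ∀ {β α} → Canonical β → Canonical α → Canonical (joinParts β α)
  canonical-joinParts cβ cα = canonical-merge _ _ cβ (canonical-scaleParts cα)

  weight-joinParts : ∀ β α → weight (joinParts β α) ≡ weight β + r * weight α
  weight-joinParts β α = trans (weight-merge β (scaleParts α)) (cong (weight β +_) (weight-scaleParts α))

  joinParts-split : ∀ {R} → Canonical R → joinParts (undivided R) (divided R) ≡ R
  joinParts-split {R} cR = trans (cong (merge (undivided R)) (scaleParts-unscaleParts (all-filter _ R)))
    (merge-filterParts-∁ (r ∣?_) cR)

  r∣scaleParts : ∀ α → AllParts (r ∣_) (scaleParts α)
  r∣scaleParts [] = []
  r∣scaleParts ((v , _) ∷ α) = n∣m*n v ∷ r∣scaleParts α

  undivided-joinParts : ∀ {β} α → AllParts (¬_ ∘ (r ∣_)) β → undivided (joinParts β α) ≡ β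
  undivided-joinParts {β} α ∤β = filterParts-merge-∁ (r ∣?_) β (scaleParts α) ∤β (r∣scaleParts α)

  divided-joinParts : ∀ {β} α → AllParts (¬_ ∘ (r ∣_)) β → divided (joinParts β α) ≡ α
  divided-joinParts {β} α ∤β =
    trans (cong unscaleParts (filterParts-merge (r ∣?_) β (scaleParts α) ∤β (r∣scaleParts α))) (unscaleParts-scaleParts α)

  scaleMults : List Run → List Run
  scaleMults = map (map₂ (_* r))

  remainders : List Run → List Run
  remainders [] = []
  remainders ((v , c) ∷ R) = consRun (v , c % r) (remainders R)

  quotients : List Run → List Run
  quotients [] = []
  quotients ((v , c) ∷ R) = consRun (v , c / r) (quotients R)

  joinMults : List Run → List Run → List Run
  joinMults ρ ν = merge ρ (scaleMults ν)

  allParts-remainders : ∀ {P R} → AllParts P R → AllParts P (remainders R)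
  allParts-remainders [] = []
  allParts-remainders {R = (_ , c) ∷ _} (pv ∷ pR) = allParts-consRun (c % r) pv (allParts-remainders pR)

  allParts-quotients : ∀ {P R} → AllParts P R → AllParts P (quotients R)
  allParts-quotients [] = []
  allParts-quotients {R = (_ , c) ∷ _} (pv ∷ pR) = allParts-consRun (c / r) pv (allParts-quotients pR)

  canonical-remainders : ∀ {R} → Canonical R → Canonical (remainders R)
  canonical-remainders [] = []
  canonical-remainders {(_ , c) ∷ _} (cons 1≤v _ bR cR) =
    canonical-consRun (c % r) 1≤v (allParts-remainders bR) (canonical-remainders cR)

  canonical-quotients : ∀ {R} → Canonical R → Canonical (quotients R)
  canonical-quotients [] = []
  canonical-quotients {(_ , c) ∷ _} (cons 1≤v _ bR cR) =
    canonical-consRun (c / r) 1≤v (allParts-quotients bR) (canonical-quotients cR)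

  remainders<r : ∀ R → AllMults (_< r) (remainders R)
  remainders<r [] = []
  remainders<r ((v , c) ∷ R) = allMults-consRun v (m%n<n c r) (remainders<r R)

  canonical-scaleMults : ∀ {ν} → Canonical ν → Canonical (scaleMults ν)
  canonical-scaleMults [] = []
  canonical-scaleMults {(_ , c) ∷ _} (cons 1≤v 1≤c bν cν) =
    cons 1≤v (≤-trans 1≤c (m≤m*n c r)) (map⁺ bν) (canonical-scaleMults cν)

  weight-scaleMults : ∀ ν → weight (scaleMults ν) ≡ r * weight ν
  weight-scaleMults [] = sym (*-zeroʳ r)
  weight-scaleMults ((v , c) ∷ ν) = begin
    c * r * v + weight (scaleMults ν) ≡⟨ cong₂ _+_ (trans (cong (_* v) (*-comm c r)) (*-assoc r c v)) (weight-scaleMults ν) ⟩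
    r * (c * v) + r * weight ν         ≡⟨ *-distribˡ-+ r (c * v) (weight ν) ⟨
    r * (c * v + weight ν)             ∎
    where open ≡-Reasoning

  canonical-joinMults : ∀ {ρ ν} → Canonical ρ → Canonical ν → Canonical (joinMults ρ ν)
  canonical-joinMults cρ cν = canonical-merge _ _ cρ (canonical-scaleMults cν)

  weight-joinMults : ∀ ρ ν → weight (joinMults ρ ν) ≡ weight ρ + r * weight ν
  weight-joinMults ρ ν = trans (weight-merge ρ (scaleMults ν)) (cong (weight ρ +_) (weight-scaleMults ν))

  joinMults-split : ∀ {R} → Canonical R → joinMults (remainders R) (quotients R) ≡ R
  joinMults-split [] = refl
  joinMults-split {(v , c) ∷ R} (cons _ 1≤c bR cR) = join (c % r) (c / r) (m≡m%n+[m/n]*n c r)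
    where
    join : ∀ a b → c ≡ a + b * r → joinMults (consRun (v , a) (remainders R)) (consRun (v , b) (quotients R)) ≡ (v , c) ∷ R
    join zero zero c≡0 = contradiction (subst (1 ≤_) c≡0 1≤c) λ ()
    join (suc a) zero c≡ = trans (merge-headˡ _ _ (map⁺ (allParts-quotients bR)))
      (cong₂ (λ m → (v , m) ∷_) (sym (trans c≡ (+-identityʳ _))) (joinMults-split cR))
    join zero (suc b) c≡ = trans (merge-headʳ _ _ (allParts-remainders bR))
      (cong₂ (λ m → (v , m) ∷_) (sym c≡) (joinMults-split cR))
    join (suc a) (suc b) c≡ = trans (merge-≡ v (suc a) (suc b * r) _ _)
      (cong₂ (λ m → (v , m) ∷_) (sym c≡) (joinMults-split cR))

  private
    +-∣-% : ∀ {c d} → r ∣ d → (c + d) % r ≡ c % r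
    +-∣-% {c} (divides q refl) = [m+kn]%n≡m%n c q r

    <-+-∣-/ : ∀ {c d} → c < r → r ∣ d → (c + d) / r ≡ d / r
    <-+-∣-/ {c} c<r r∣d = trans (+-distrib-/-∣ʳ c r∣d) (cong (_+ _) (m<n⇒m/n≡0 c<r))

  remainders-divisible : ∀ {S} → AllMults (r ∣_) S → remainders S ≡ []
  remainders-divisible [] = refl
  remainders-divisible {(_ , d) ∷ _} (r∣d ∷ r∣S) rewrite n∣m⇒m%n≡0 d r r∣d = remainders-divisible r∣S

  quotients-small : ∀ {R} → AllMults (_< r) R → quotients R ≡ []
  quotients-small [] = refl
  quotients-small (c<r ∷ small) rewrite m<n⇒m/n≡0 c<r = quotients-small small

  remainders-merge : ∀ R S → AllMults (_< r) R → AllMults (r ∣_) S → remainders (merge R S) ≡ remainders R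
  remainders-merge = merge-elim (λ R S M → AllMults (_< r) R → AllMults (r ∣_) S → remainders M ≡ remainders R)
    (λ _ _ → remainders-divisible)
    (λ _ _ _ _ → refl)
    (λ { _ _ _ u d _ _ ih small (r∣d ∷ r∣S) →
           trans (cong (λ m → consRun (u , m) _) (n∣m⇒m%n≡0 d r r∣d)) (ih small r∣S) })
    (λ { v _ _ _ _ _ refl ih (_ ∷ small) (r∣d ∷ r∣S) → cong₂ (λ m → consRun (v , m)) (+-∣-% r∣d) (ih small r∣S) })
    (λ { v c _ _ _ _ _ ih (_ ∷ small) r∣S → cong (consRun (v , c % r)) (ih small r∣S) })

  quotients-merge : ∀ R S → AllMults (_< r) R → AllMults (r ∣_) S → quotients (merge R S) ≡ quotients S
  quotients-merge = merge-elim (λ R S M → AllMults (_< r) R → AllMults (r ∣_) S → quotients M ≡ quotients S)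
    (λ _ _ _ → refl)
    (λ _ _ small _ → quotients-small small)
    (λ { _ _ _ u d _ _ ih small (_ ∷ r∣S) → cong (consRun (u , d / r)) (ih small r∣S) })
    (λ { v _ _ _ _ _ refl ih (c<r ∷ small) (r∣d ∷ r∣S) → cong₂ (λ m → consRun (v , m)) (<-+-∣-/ c<r r∣d) (ih small r∣S) })
    (λ { v _ _ _ _ _ _ ih (c<r ∷ small) r∣S →
           trans (cong (λ m → consRun (v , m) _) (m<n⇒m/n≡0 c<r)) (ih small r∣S) })

  remainders-small : ∀ {R} → NoRepeatingPart R → remainders R ≡ R
  remainders-small ([] , []) = refl
  remainders-small (cons {c = c} _ 1≤c _ cR , c<r ∷ small) =
    trans (cong₂ (λ m → consRun (_ , m)) (m<n⇒m%n≡m c<r) (remainders-small (cR , small))) (consRun-suc 1≤c)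

  quotients-scaleMults : ∀ {ν} → Canonical ν → quotients (scaleMults ν) ≡ ν
  quotients-scaleMults [] = refl
  quotients-scaleMults (cons {c = c} _ 1≤c _ cν) =
    trans (cong₂ (λ m → consRun (_ , m)) (m*n/n≡m c r) (quotients-scaleMults cν)) (consRun-suc 1≤c)

  r∣scaleMults : ∀ ν → AllMults (r ∣_) (scaleMults ν)
  r∣scaleMults [] = []
  r∣scaleMults ((_ , c) ∷ ν) = n∣m*n c ∷ r∣scaleMults ν

  remainders-joinMults : ∀ {ρ} ν → NoRepeatingPart ρ → remainders (joinMults ρ ν) ≡ ρ
  remainders-joinMults {ρ} ν nρ@(_ , small) = trans (remainders-merge ρ (scaleMults ν) small (r∣scaleMults ν)) (remainders-small nρ)

  quotients-joinMults : ∀ {ρ ν} → AllMults (_< r) ρ → Canonical ν → quotients (joinMults ρ ν) ≡ ν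
  quotients-joinMults {ρ} {ν} small cν = trans (quotients-merge ρ (scaleMults ν) small (r∣scaleMults ν)) (quotients-scaleMults cν)

  weight-remainders-quotients : ∀ {R} → Canonical R → weight R ≡ weight (remainders R) + r * weight (quotients R)
  weight-remainders-quotients {R} cR = trans (cong weight (sym (joinMults-split cR))) (weight-joinMults (remainders R) (quotients R))

  weight-undivided-divided : ∀ {R} → Canonical R → weight R ≡ weight (undivided R) + r * weight (divided R)
  weight-undivided-divided {R} cR = trans (cong weight (sym (joinParts-split cR))) (weight-joinParts (undivided R) (divided R))


  -- Glaisher's bijection

  noDivisiblePart-quotients : ∀ {β} → NoDivisiblePart β → NoDivisiblePart (quotients β)
  noDivisiblePart-quotients (cβ , ∤β) = canonical-quotients cβ , allParts-quotients ∤β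

  noRepeatingPart-undivided : ∀ {ρ} → NoRepeatingPart ρ → NoRepeatingPart (undivided ρ)
  noRepeatingPart-undivided (cρ , small) = canonical-filter _ cρ , filter⁺ _ small

  noRepeatingPart-divided : ∀ {ρ} → NoRepeatingPart ρ → NoRepeatingPart (divided ρ)
  noRepeatingPart-divided (cρ , small) = canonical-divided cρ , map⁺ (filter⁺ _ small)

  weight-quotients-≤ : ∀ {β f} → NoDivisiblePart β → weight β ≤ suc f → weight (quotients β) ≤ f
  weight-quotients-≤ (cβ , ∤β) le = fuel-descent r (only-[] ∤β) (subst (_≤ _) (weight-remainders-quotients cβ) le)
    where
    only-[] : ∀ {β} → AllParts (¬_ ∘ (r ∣_)) β → r ≡ 1 → weight (quotients β) ≡ 0
    only-[] [] _ = refl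
    only-[] {(v , _) ∷ _} (¬r∣v ∷ _) r≡1 = contradiction (subst (_∣ v) (sym r≡1) (1∣ v)) ¬r∣v

  weight-divided-≤ : ∀ {ρ f} → NoRepeatingPart ρ → weight ρ ≤ suc f → weight (divided ρ) ≤ f
  weight-divided-≤ (cρ , small) le = fuel-descent r (only-[] cρ small) (subst (_≤ _) (weight-undivided-divided cρ) le)
    where
    only-[] : ∀ {ρ} → Canonical ρ → AllMults (_< r) ρ → r ≡ 1 → weight (divided ρ) ≡ 0
    only-[] [] [] _ = refl
    only-[] (cons _ 1≤c _ _) (c<r ∷ _) r≡1 = contradiction (subst (_ <_) r≡1 c<r) (<⇒≱ (s≤s 1≤c))

  -- The fuel f only needs to bound the weight of the argument.
  glaisher : ℕ → List Run → List Run
  glaisher zero _ = []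
  glaisher (suc f) β = joinParts (remainders β) (glaisher f (quotients β))

  glaisher⁻¹ : ℕ → List Run → List Run
  glaisher⁻¹ zero _ = []
  glaisher⁻¹ (suc f) ρ = joinMults (undivided ρ) (glaisher⁻¹ f (divided ρ))

  glaisher-noRepeatingPart : ∀ f {β} → NoDivisiblePart β → NoRepeatingPart (glaisher f β)
  glaisher-noRepeatingPart zero _ = [] , []
  glaisher-noRepeatingPart (suc f) {β} nβ@(cβ , ∤β) with glaisher-noRepeatingPart f (noDivisiblePart-quotients nβ)
  ... | cG , smallG = canonical-joinParts (canonical-remainders cβ) cG ,
    allMults-merge _ _ (remainders<r β) (map⁺ smallG) (allParts-remainders ∤β) (r∣scaleParts _)

  glaisher⁻¹-noDivisiblePart : ∀ f {ρ} → NoRepeatingPart ρ → NoDivisiblePart (glaisher⁻¹ f ρ)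
  glaisher⁻¹-noDivisiblePart zero _ = [] , []
  glaisher⁻¹-noDivisiblePart (suc f) {ρ} nρ@(cρ , _) with glaisher⁻¹-noDivisiblePart f (noRepeatingPart-divided nρ)
  ... | cH , ∤H = canonical-joinMults (canonical-filter _ cρ) cH , allParts-merge _ _ (all-filter _ ρ) (map⁺ ∤H)

  weight-glaisher : ∀ f {β} → NoDivisiblePart β → weight β ≤ f → weight (glaisher f β) ≡ weight β
  weight-glaisher zero _ le = sym (n≤0⇒n≡0 le)
  weight-glaisher (suc f) {β} nβ@(cβ , _) le = begin
    weight (joinParts (remainders β) (glaisher f (quotients β)))
      ≡⟨ weight-joinParts (remainders β) _ ⟩
    weight (remainders β) + r * weight (glaisher f (quotients β))
      ≡⟨ cong (λ w → weight (remainders β) + r * w) (weight-glaisher f (noDivisiblePart-quotients nβ) (weight-quotients-≤ nβ le)) ⟩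
    weight (remainders β) + r * weight (quotients β)
      ≡⟨ weight-remainders-quotients cβ ⟨
    weight β ∎
    where open ≡-Reasoning

  weight-glaisher⁻¹ : ∀ f {ρ} → NoRepeatingPart ρ → weight ρ ≤ f → weight (glaisher⁻¹ f ρ) ≡ weight ρ
  weight-glaisher⁻¹ zero _ le = sym (n≤0⇒n≡0 le)
  weight-glaisher⁻¹ (suc f) {ρ} nρ@(cρ , _) le = begin
    weight (joinMults (undivided ρ) (glaisher⁻¹ f (divided ρ)))
      ≡⟨ weight-joinMults (undivided ρ) _ ⟩
    weight (undivided ρ) + r * weight (glaisher⁻¹ f (divided ρ))
      ≡⟨ cong (λ w → weight (undivided ρ) + r * w) (weight-glaisher⁻¹ f (noRepeatingPart-divided nρ) (weight-divided-≤ nρ le)) ⟩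
    weight (undivided ρ) + r * weight (divided ρ)
      ≡⟨ weight-undivided-divided cρ ⟨
    weight ρ ∎
    where open ≡-Reasoning

  glaisher⁻¹-glaisher : ∀ f {β} → NoDivisiblePart β → weight β ≤ f → glaisher⁻¹ f (glaisher f β) ≡ β
  glaisher⁻¹-glaisher zero (cβ , _) le = sym (weight≤0⇒[] cβ le)
  glaisher⁻¹-glaisher (suc f) {β} nβ@(cβ , ∤β) le = begin
    joinMults (undivided G) (glaisher⁻¹ f (divided G))
      ≡⟨ cong₂ (λ X Y → joinMults X (glaisher⁻¹ f Y)) (undivided-joinParts _ (allParts-remainders ∤β)) (divided-joinParts _ (allParts-remainders ∤β)) ⟩
    joinMults (remainders β) (glaisher⁻¹ f (glaisher f (quotients β)))
      ≡⟨ cong (joinMults (remainders β)) (glaisher⁻¹-glaisher f (noDivisiblePart-quotients nβ) (weight-quotients-≤ nβ le)) ⟩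
    joinMults (remainders β) (quotients β)
      ≡⟨ joinMults-split cβ ⟩
    β ∎
    where
    open ≡-Reasoning
    G = glaisher (suc f) β

  glaisher-glaisher⁻¹ : ∀ f {ρ} → NoRepeatingPart ρ → weight ρ ≤ f → glaisher f (glaisher⁻¹ f ρ) ≡ ρ
  glaisher-glaisher⁻¹ zero (cρ , _) le = sym (weight≤0⇒[] cρ le)
  glaisher-glaisher⁻¹ (suc f) {ρ} nρ@(cρ , small) le = begin
    joinParts (remainders H) (glaisher f (quotients H))
      ≡⟨ cong₂ (λ X Y → joinParts X (glaisher f Y)) (remainders-joinMults _ (noRepeatingPart-undivided nρ)) (quotients-joinMults (filter⁺ _ small) cH) ⟩
    joinParts (undivided ρ) (glaisher f (glaisher⁻¹ f (divided ρ)))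
      ≡⟨ cong (joinParts (undivided ρ)) (glaisher-glaisher⁻¹ f (noRepeatingPart-divided nρ) (weight-divided-≤ nρ le)) ⟩
    joinParts (undivided ρ) (divided ρ)
      ≡⟨ joinParts-split cρ ⟩
    ρ ∎
    where
    open ≡-Reasoning
    H = glaisher⁻¹ (suc f) ρ
    cH = proj₁ (glaisher⁻¹-noDivisiblePart f (noRepeatingPart-divided nρ))

  size-unscaleParts : ∀ R → size (unscaleParts R) ≡ size R
  size-unscaleParts R = cong sum (sym (map-∘ R))

  largest-quotients : ∀ R → largest (quotients R) ≡ largest (filter ((r ≤?_) ∘ proj₂) R)
  largest-quotients [] = refl
  largest-quotients ((v , c) ∷ R) with r ≤? c
  ... | yes r≤c = trans (cong largest (consRun-suc (m≥n⇒m/n>0 r≤c))) (cong largest (sym (filter-accept ((r ≤?_) ∘ proj₂) r≤c)))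
  ... | no r≰c = begin
    largest (consRun (v , c / r) (quotients R))     ≡⟨ cong (λ m → largest (consRun (v , m) (quotients R))) (m<n⇒m/n≡0 (≰⇒> r≰c)) ⟩
    largest (quotients R)                          ≡⟨ largest-quotients R ⟩
    largest (filter ((r ≤?_) ∘ proj₂) R)           ≡⟨ cong largest (filter-reject ((r ≤?_) ∘ proj₂) r≰c) ⟨
    largest (filter ((r ≤?_) ∘ proj₂) ((v , c) ∷ R)) ∎
    where open ≡-Reasoning

  φ : ℕ → List Run → List Run
  φ n R = joinMults (glaisher n (undivided R)) (conjugate (divided R))

  φ⁻¹ : ℕ → List Run → List Run
  φ⁻¹ n S = joinParts (glaisher⁻¹ n (remainders S)) (conjugate (quotients S))

  private
    summand-≤ : ∀ {n R} → IsRunPartition n R → ∀ {a b} → weight R ≡ a + r * b → a ≤ n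
    summand-≤ (_ , refl) eq = subst (_ ≤_) (sym eq) (m≤m+n _ _)

  module _ {n R} (nR : IsRunPartition n R) where
    private
      cR = proj₁ nR
      nβ = noDivisiblePart-undivided cR
      β≤n = summand-≤ nR (weight-undivided-divided cR)
      cα = canonical-divided cR
      nG = glaisher-noRepeatingPart n nβ
      quotients-φ : quotients (φ n R) ≡ conjugate (divided R)
      quotients-φ = quotients-joinMults (proj₂ nG) (canonical-conjugate cα)

    isRunPartition-φ : IsRunPartition n (φ n R)
    isRunPartition-φ = canonical-joinMults (proj₁ nG) (canonical-conjugate cα) , (begin
      weight (φ n R)
        ≡⟨ weight-joinMults (glaisher n (undivided R)) _ ⟩
      weight (glaisher n (undivided R)) + r * weight (conjugate (divided R))
        ≡⟨ cong₂ (λ a b → a + r * b) (weight-glaisher n nβ β≤n) (weight-conjugate cα) ⟩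
      weight (undivided R) + r * weight (divided R)
        ≡⟨ weight-undivided-divided cR ⟨
      weight R
        ≡⟨ proj₂ nR ⟩
      n ∎)
      where open ≡-Reasoning

    φ⁻¹-φ : φ⁻¹ n (φ n R) ≡ R
    φ⁻¹-φ = begin
      joinParts (glaisher⁻¹ n (remainders (φ n R))) (conjugate (quotients (φ n R)))
        ≡⟨ cong₂ (λ X Y → joinParts (glaisher⁻¹ n X) (conjugate Y)) (remainders-joinMults _ nG) quotients-φ ⟩
      joinParts (glaisher⁻¹ n (glaisher n (undivided R))) (conjugate (conjugate (divided R)))
        ≡⟨ cong₂ joinParts (glaisher⁻¹-glaisher n nβ β≤n) (conjugate-involutive cα) ⟩
      joinParts (undivided R) (divided R)
        ≡⟨ joinParts-split cR ⟩
      R ∎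
      where open ≡-Reasoning

    largestRepeatingPart-φ : largestRepeatingPart r (expand (φ n R)) ≡ partsDivisibleBy r (expand R)
    largestRepeatingPart-φ = begin
      largestRepeatingPart r (expand (φ n R))     ≡⟨ largestRepeatingPart-expand r (proj₁ isRunPartition-φ) ⟩
      largest (filter ((r ≤?_) ∘ proj₂) (φ n R)) ≡⟨ largest-quotients (φ n R) ⟨
      largest (quotients (φ n R))                ≡⟨ cong largest quotients-φ ⟩
      largest (conjugate (divided R))            ≡⟨ largest-conjugate (divided R) ⟩
      size (divided R)                           ≡⟨ size-unscaleParts (filterParts (r ∣?_) R) ⟩
      size (filterParts (r ∣?_) R)               ≡⟨ partsDivisibleBy-expand r R ⟨
      partsDivisibleBy r (expand R)              ∎
      where open ≡-Reasoning

  module _ {n S} (nS : IsRunPartition n S) where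
    private
      cS = proj₁ nS
      nρ = canonical-remainders cS , remainders<r S
      ρ≤n = summand-≤ nS (weight-remainders-quotients cS)
      cν = canonical-quotients cS
      nH = glaisher⁻¹-noDivisiblePart n nρ

    isRunPartition-φ⁻¹ : IsRunPartition n (φ⁻¹ n S)
    isRunPartition-φ⁻¹ = canonical-joinParts (proj₁ nH) (canonical-conjugate cν) , (begin
      weight (φ⁻¹ n S)
        ≡⟨ weight-joinParts (glaisher⁻¹ n (remainders S)) _ ⟩
      weight (glaisher⁻¹ n (remainders S)) + r * weight (conjugate (quotients S))
        ≡⟨ cong₂ (λ a b → a + r * b) (weight-glaisher⁻¹ n nρ ρ≤n) (weight-conjugate cν) ⟩
      weight (remainders S) + r * weight (quotients S)
        ≡⟨ weight-remainders-quotients cS ⟨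
      weight S
        ≡⟨ proj₂ nS ⟩
      n ∎)
      where open ≡-Reasoning

    φ-φ⁻¹ : φ n (φ⁻¹ n S) ≡ S
    φ-φ⁻¹ = begin
      joinMults (glaisher n (undivided (φ⁻¹ n S))) (conjugate (divided (φ⁻¹ n S)))
        ≡⟨ cong₂ (λ X Y → joinMults (glaisher n X) (conjugate Y)) (undivided-joinParts _ (proj₂ nH)) (divided-joinParts _ (proj₂ nH)) ⟩
      joinMults (glaisher n (glaisher⁻¹ n (remainders S))) (conjugate (conjugate (quotients S)))
        ≡⟨ cong₂ joinMults (glaisher-glaisher⁻¹ n nρ ρ≤n) (conjugate-involutive cν) ⟩
      joinMults (remainders S) (quotients S)
        ≡⟨ joinMults-split cS ⟩
      S ∎
      where open ≡-Reasoning

proposition2p3 : (r j n : ℕ) → NonZero r →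
    (Σ (List ℕ) (λ p → IsPartition n p × partsDivisibleBy r p ≡ j))
      ↔ (Σ (List ℕ) (λ p → IsPartition n p × largestRepeatingPart r p ≡ j))
proposition2p3 r j n r≢0 = partitions-↔ (partsDivisibleBy r) (largestRepeatingPart r) (φ r n) (φ⁻¹ r n)
  (isRunPartition-φ r) (isRunPartition-φ⁻¹ r) (φ⁻¹-φ r) (φ-φ⁻¹ r) (largestRepeatingPart-φ r) j
  where instance _ = r≢0
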